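{- Let $h\ge 2$ and let $p_1,\dots,p_h$ be primes with $p_i\neq p_{i+1}$ for $i=1,\dots,h-1$. Then there are $\mathrm{CC}[p_1;\dots;p_h]$-circuits of size $2^{O(n^{1/(h-1)})}$ computing the $n$-ary conjunction $\mathrm{AND}_n$.
   Context: For $A\subseteq\{0,\dots,m-1\}$, the gate $\mathrm{MOD}_m^A$ (unbounded fan-in) outputs $1$ iff the sum of its boolean inputs modulo $m$ lies in $A$; multiple wires between gates (including input gates) are allowed. A $\mathrm{CC}[m_1;\dots;m_h]$-circuit is a depth-$h$ circuit whose gates on the $i$-th level (counted from the inputs) are of the form $\mathrm{MOD}_{m_i}^A$ (arbitrary $A$). Size is the number of gates. -}

module Defs where

open import Data.Nat using (ℕ; zero; suc; _+_; _*_; NonZero)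
open import Data.Nat.DivMod using (_mod_)
open import Data.Fin using (Fin; zero; suc)
open import Data.Bool using (Bool; true; false; _∧_; if_then_else_)
open import Data.Product using (_×_; _,_; proj₁; proj₂)
open import Data.Vec using (Vec; []; _∷_)

sumFin : (k : ℕ) → (Fin k → ℕ) → ℕ
sumFin zero    f = 0
sumFin (suc k) f = f zero + sumFin k (λ j → f (suc j))

AND : (n : ℕ) → (Fin n → Bool) → Bool
AND zero    x = true
AND (suc n) x = x zero ∧ AND n (λ j → x (suc j))

-- MOD_m^A gate: inputs are given with multiplicities w j (number of wires
-- from wire j), A ⊆ {0,…,m-1} given as its characteristic function.
modGate : (m : ℕ) .{{_ : NonZero m}} → (Fin m → Bool) →
          (k : ℕ) → (Fin k → ℕ) → (Fin k → Bool) → Bool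
modGate m A k w x = A (sumFin k (λ j → w j * (if x j then 1 else 0)) mod m)

-- A layered circuit reading k wires from below, whose layers (from bottom to
-- top) use moduli ms.  Each layer of width k' consists of k' gates
-- MOD_m^A, each given by its set A and the multiplicities of wires from the
-- k gates (or inputs) of the level below.
data Circ : (k : ℕ) → {d : ℕ} → Vec ℕ d → Set where
  output : Circ 1 []
  layer  : ∀ {k d} {ms : Vec ℕ d} (m : ℕ) .{{_ : NonZero m}} (k' : ℕ) →
           (Fin k' → (Fin m → Bool) × (Fin k → ℕ)) →
           Circ k' ms → Circ k (m ∷ ms)

eval : ∀ {k d} {ms : Vec ℕ d} → Circ k ms → (Fin k → Bool) → Bool
eval output x = x zero
eval (layer m k' gs C) x =
  eval C (λ g → modGate m (proj₁ (gs g)) _ (proj₂ (gs g)) x)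

size : ∀ {k d} {ms : Vec ℕ d} → Circ k ms → ℕ
size output = 0
size (layer m k' gs C) = k' + size C

-- C is a CC[p₁;…;p_h]-circuit on n inputs (p₁ at the level next to the inputs)
CC : (n : ℕ) → {h : ℕ} → Vec ℕ h → Set
CC n ps = Circ n ps

-- Fix a fan-in R = r + 1 and view the inputs, padded with ones up to R^(h-1), as the leaves of a
-- complete R-ary tree. For a prime p and z ∈ {0,1}^R, the number of a ∈ ℤ_p^R with
-- Σ a_k z_k ≡ 1 (mod p) is p^r if z ≠ 0 and 0 otherwise. Hence a layer of MOD_p gates, one for each
-- block of R siblings and each a, in which gate (v , a) tests this congruence for z = ¬ (block v),
-- contains exactly p^r·[block v is not all ones] accepting gates per block. A MOD_q gate with q ≠ p
-- reading these with weight b_k on the gates of child k sees p^r·Σ_k b_k [child k is not all ones],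
-- and since q ∤ p^r it can test the same congruence one level higher. Every level therefore has at
-- most R^(h-2)·K^R gates for K bounding the primes, and the top MOD_q gate tests whether the last
-- count vanishes. This gives size 2^(O(r)) for n ≤ r^(h-1).

module Submission where

open import Algebra.Bundles using (CommutativeMonoid)
open import Data.Bool using (Bool; true; false; _∧_; not; if_then_else_)
open import Data.Bool.Properties using (∧-commutativeMonoid; ∧-assoc; ∧-identityʳ)
open import Data.Fin using (Fin; zero; suc; toℕ; combine; remQuot; quotient; remainder; _↑ˡ_; _↑ʳ_)
open import Data.Fin.Properties using (toℕ<n; toℕ-fromℕ<; fromℕ<-cong; remQuot-combine; _≟_)
open import Data.Nat using (ℕ; zero; suc; _+_; _*_; _^_; _∸_; _≤_; z≤n; s≤s; pred; _%_; _/_; _≡ᵇ_;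
  NonZero; >-nonZero⁻¹; nonTrivial⇒≢1; nonTrivial⇒n>1)
open import Data.Nat.DivMod using (_mod_; m≡m%n+[m/n]*n; m%n%n≡m%n; [m+n]%n≡m%n; m<n⇒m%n≡m;
  %-distribˡ-+; %-distribˡ-*; %-remove-+ʳ)
open import Data.Nat.Divisibility
  using (_∣_; _∤_; divides; m%n≡0⇒n∣m; n∣m*n; m∣m*n; ∣m+n∣m⇒∣n; ∣1⇒≡1)
open import Data.Nat.Primality using (Prime; euclidsLemma; prime⇒irreducible; prime⇒nonTrivial; prime⇒nonZero)
open import Data.Nat.Properties renaming (_≟_ to _≟ℕ_)
open import Data.Nat.Tactic.RingSolver using (solve-∀)
open import Data.Product using (Σ; ∃; _×_; _,_; proj₁; proj₂; uncurry)
open import Data.Sum using (inj₁; inj₂)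
open import Data.Vec using (Vec; []; _∷_; lookup; sum)
open import Data.Vec.Functional using (_++_) renaming (_∷_ to _∷ᶠ_)
open import Data.Vec.Functional.Properties using (lookup-++ˡ; lookup-++ʳ)
open import Function.Bundles using (mk⇔)
open import Relation.Binary.PropositionalEquality
open import Relation.Nullary using (does; contradiction)
open import Relation.Nullary.Decidable using (does-⇔; dec-true; dec-false)
open import Algebra.Properties.CommutativeSemigroup +-commutativeSemigroup
  using () renaming (interchange to +-interchange)
open import Algebra.Properties.CommutativeSemigroup *-commutativeSemigroup
  using (x∙yz≈y∙xz)
open import Algebra.Properties.CommutativeSemigroup (CommutativeMonoid.commutativeSemigroup ∧-commutativeMonoid)
  using () renaming (interchange to ∧-interchange)

open import Defs

ind : Bool → ℕ
ind b = if b then 1 else 0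

uncurryFin : ∀ {m n} {A : Set} → (Fin m → Fin n → A) → Fin (m * n) → A
uncurryFin {n = n} f g = uncurry f (remQuot n g)

uncurryFin-combine : ∀ {m n} {A : Set} (f : Fin m → Fin n → A) i j → uncurryFin f (combine i j) ≡ f i j
uncurryFin-combine f i j = cong (uncurry f) (remQuot-combine i j)

sumFin-cong : ∀ k {f g : Fin k → ℕ} → (∀ i → f i ≡ g i) → sumFin k f ≡ sumFin k g
sumFin-cong zero    eq = refl
sumFin-cong (suc k) eq = cong₂ _+_ (eq zero) (sumFin-cong k (λ i → eq (suc i)))

sumFin-const : ∀ k c → sumFin k (λ _ → c) ≡ k * c
sumFin-const zero    c = refl
sumFin-const (suc k) c = cong (c +_) (sumFin-const k c)

sumFin-+ : ∀ k (f g : Fin k → ℕ) → sumFin k (λ i → f i + g i) ≡ sumFin k f + sumFin k g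
sumFin-+ zero    f g = refl
sumFin-+ (suc k) f g = trans (cong (f zero + g zero +_) (sumFin-+ k _ _))
                             (+-interchange (f zero) (g zero) _ _)

sumFin-*ˡ : ∀ k c (f : Fin k → ℕ) → sumFin k (λ i → c * f i) ≡ c * sumFin k f
sumFin-*ˡ zero    c f = sym (*-zeroʳ c)
sumFin-*ˡ (suc k) c f = trans (cong (c * f zero +_) (sumFin-*ˡ k c _)) (sym (*-distribˡ-+ c _ _))

sumFin-↑ : ∀ m n (f : Fin (m + n) → ℕ) →
           sumFin (m + n) f ≡ sumFin m (λ i → f (i ↑ˡ n)) + sumFin n (λ j → f (m ↑ʳ j))
sumFin-↑ zero    n f = refl
sumFin-↑ (suc m) n f = trans (cong (f zero +_) (sumFin-↑ m n (λ i → f (suc i)))) (sym (+-assoc (f zero) _ _))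

sumFin-combine : ∀ m n (f : Fin (m * n) → ℕ) →
                 sumFin (m * n) f ≡ sumFin m (λ i → sumFin n (λ j → f (combine i j)))
sumFin-combine zero    n f = refl
sumFin-combine (suc m) n f = trans (sumFin-↑ n (m * n) f)
  (cong (sumFin n (λ j → f (j ↑ˡ (m * n))) +_) (sumFin-combine m n (λ i → f (n ↑ʳ i))))

sumFin-uncurry : ∀ m n (f : Fin m → Fin n → ℕ) →
                 sumFin (m * n) (uncurryFin f) ≡ sumFin m (λ i → sumFin n (f i))
sumFin-uncurry m n f = trans (sumFin-combine m n (uncurryFin f))
  (sumFin-cong m (λ i → sumFin-cong n (uncurryFin-combine f i)))

sumFin-indicator : ∀ k (v : Fin k) (f : Fin k → ℕ) → sumFin k (λ u → ind (does (u ≟ v)) * f u) ≡ f v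
sumFin-indicator (suc k) zero    f = begin
  f zero + 0 + sumFin k (λ _ → 0) ≡⟨ cong (f zero + 0 +_) (trans (sumFin-const k 0) (*-zeroʳ k)) ⟩
  f zero + 0 + 0                  ≡⟨ +-identityʳ _ ⟩
  f zero + 0                      ≡⟨ +-identityʳ _ ⟩
  f zero                          ∎
  where open ≡-Reasoning
sumFin-indicator (suc k) (suc v) f = sumFin-indicator k v (λ u → f (suc u))

sumFin-shift : ∀ k (g : ℕ → ℕ) →
               sumFin k (λ a → g (suc (toℕ a))) + g 0 ≡ sumFin k (λ a → g (toℕ a)) + g k
sumFin-shift zero    g = refl
sumFin-shift (suc k) g = begin
  g 1 + X + g 0       ≡⟨ +-comm (g 1 + X) (g 0) ⟩
  g 0 + (g 1 + X)     ≡⟨ cong (g 0 +_) (+-comm (g 1) X) ⟩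
  g 0 + (X + g 1)     ≡⟨ cong (g 0 +_) (sumFin-shift k (λ b → g (suc b))) ⟩
  g 0 + (Y + g (suc k)) ≡⟨ sym (+-assoc (g 0) Y _) ⟩
  g 0 + Y + g (suc k) ∎
  where
  open ≡-Reasoning
  X = sumFin k (λ a → g (suc (suc (toℕ a))))
  Y = sumFin k (λ a → g (suc (toℕ a)))

sumFin-rotate : ∀ p .{{_ : NonZero p}} (f : ℕ → ℕ) t →
                sumFin p (λ a → f ((t + toℕ a) % p)) ≡ sumFin p (λ a → f (toℕ a))
sumFin-rotate p f zero    = sumFin-cong p (λ a → cong f (m<n⇒m%n≡m (toℕ<n a)))
sumFin-rotate p f (suc t) = begin
  sumFin p (λ a → f ((suc t + toℕ a) % p))
    ≡⟨ sumFin-cong p (λ a → cong (λ s → f (s % p)) (sym (+-suc t (toℕ a)))) ⟩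
  sumFin p (λ a → g (suc (toℕ a)))  ≡⟨ +-cancelʳ-≡ _ _ _ shifted ⟩
  sumFin p (λ a → g (toℕ a))        ≡⟨ sumFin-rotate p f t ⟩
  sumFin p (λ a → f (toℕ a))        ∎
  where
  open ≡-Reasoning
  g : ℕ → ℕ
  g b = f ((t + b) % p)
  shifted : sumFin p (λ a → g (suc (toℕ a))) + g 0 ≡ sumFin p (λ a → g (toℕ a)) + g 0
  shifted = trans (sumFin-shift p g)
    (cong (λ s → sumFin p (λ a → g (toℕ a)) + f s)
      (trans ([m+n]%n≡m%n t p) (cong (_% p) (sym (+-identityʳ t)))))

sumFin-residue≡1 : ∀ p .{{_ : NonZero p}} → 2 ≤ p → ∀ t →
                   sumFin p (λ a → ind ((t + toℕ a) % p ≡ᵇ 1)) ≡ 1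
sumFin-residue≡1 p@(suc (suc p′)) (s≤s (s≤s z≤n)) t = trans (sumFin-rotate p (λ s → ind (s ≡ᵇ 1)) t)
  (cong suc (trans (sumFin-const p′ 0) (*-zeroʳ p′)))

[m+n]%d≡m%d⇒d∣n : ∀ m n d .{{_ : NonZero d}} → (m + n) % d ≡ m % d → d ∣ n
[m+n]%d≡m%d⇒d∣n m n d eq = ∣m+n∣m⇒∣n (divides ((m + n) / d) (+-cancelˡ-≡ (m % d) _ _ (begin
    m % d + (m / d * d + n) ≡⟨ sym (+-assoc (m % d) _ n) ⟩
    m % d + m / d * d + n   ≡⟨ cong (_+ n) (sym (m≡m%n+[m/n]*n m d)) ⟩
    m + n                   ≡⟨ m≡m%n+[m/n]*n (m + n) d ⟩
    (m + n) % d + (m + n) / d * d ≡⟨ cong (_+ (m + n) / d * d) eq ⟩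
    m % d + (m + n) / d * d ∎)))
  (n∣m*n (m / d))
  where open ≡-Reasoning

e*[¬b]%q≡ᵇ0≡b : ∀ {q} .{{_ : NonZero q}} {e} → q ∤ e → ∀ b → ((e * ind (not b)) % q ≡ᵇ 0) ≡ b
e*[¬b]%q≡ᵇ0≡b {q} {e} q∤e true  = dec-true ((e * 0) % q ≟ℕ 0)
  (trans (cong (_% q) (*-zeroʳ e)) (m<n⇒m%n≡m (>-nonZero⁻¹ q)))
e*[¬b]%q≡ᵇ0≡b {q} {e} q∤e false = dec-false ((e * 1) % q ≟ℕ 0)
  (λ e%q≡0 → q∤e (subst (q ∣_) (*-identityʳ e) (m%n≡0⇒n∣m _ q e%q≡0)))

module _ {q} .{{_ : NonZero q}} (prime-q : Prime q) {e} (q∤e : q ∤ e) where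

  private
    cancel≤ : ∀ x y → x ≤ y → (e * x) % q ≡ (e * y) % q → x % q ≡ y % q
    cancel≤ x y x≤y eq with m≤n⇒∃[o]m+o≡n x≤y
    ... | k , refl with euclidsLemma e k prime-q
          ([m+n]%d≡m%d⇒d∣n (e * x) (e * k) q (trans (cong (_% q) (sym (*-distribˡ-+ e x k))) (sym eq)))
    ...   | inj₁ q∣e = contradiction q∣e q∤e
    ...   | inj₂ q∣k = sym (%-remove-+ʳ x q∣k)

  *-cancelˡ-% : ∀ x y → (e * x) % q ≡ (e * y) % q → x % q ≡ y % q
  *-cancelˡ-% x y eq with ≤-total x y
  ... | inj₁ x≤y = cancel≤ x y x≤y eq
  ... | inj₂ y≤x = sym (cancel≤ y x y≤x (sym eq))

  *-≡ᵇ-cancelˡ : ∀ x → ((e * x) % q ≡ᵇ e % q) ≡ (x % q ≡ᵇ 1)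
  *-≡ᵇ-cancelˡ x = does-⇔ (mk⇔ cancel scale) ((e * x) % q ≟ℕ e % q) (x % q ≟ℕ 1)
    where
    cancel : (e * x) % q ≡ e % q → x % q ≡ 1
    cancel eq = trans (*-cancelˡ-% x 1 (trans eq (cong (_% q) (sym (*-identityʳ e)))))
                      (m<n⇒m%n≡m (nonTrivial⇒n>1 q {{prime⇒nonTrivial prime-q}}))
    scale : x % q ≡ 1 → (e * x) % q ≡ e % q
    scale eq = begin
      (e * x) % q             ≡⟨ %-distribˡ-* e x q ⟩
      (e % q * (x % q)) % q   ≡⟨ cong (λ s → (e % q * s) % q) eq ⟩
      (e % q * 1) % q         ≡⟨ cong (_% q) (*-identityʳ (e % q)) ⟩
      e % q % q               ≡⟨ m%n%n≡m%n e q ⟩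
      e % q                   ∎
      where open ≡-Reasoning

prime∤prime^ : ∀ {p q} → Prime p → Prime q → p ≢ q → ∀ k → q ∤ p ^ k
prime∤prime^ prime-p prime-q p≢q zero    q∣1 = nonTrivial⇒≢1 {{prime⇒nonTrivial prime-q}} (∣1⇒≡1 q∣1)
prime∤prime^ {p} prime-p prime-q p≢q (suc k) q∣p^k with euclidsLemma p (p ^ k) prime-q q∣p^k
... | inj₂ q∣p^k = prime∤prime^ prime-p prime-q p≢q k q∣p^k
... | inj₁ q∣p with prime⇒irreducible prime-p q∣p
...   | inj₁ q≡1 = nonTrivial⇒≢1 {{prime⇒nonTrivial prime-q}} q≡1
...   | inj₂ q≡p = p≢q (sym q≡p)

[m%d+n]%d≡[m+n]%d : ∀ m n d .{{_ : NonZero d}} → (m % d + n) % d ≡ (m + n) % d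
[m%d+n]%d≡[m+n]%d m n d = begin
  (m % d + n) % d         ≡⟨ %-distribˡ-+ (m % d) n d ⟩
  (m % d % d + n % d) % d ≡⟨ cong (λ s → (s + n % d) % d) (m%n%n≡m%n m d) ⟩
  (m % d + n % d) % d     ≡⟨ sym (%-distribˡ-+ m n d) ⟩
  (m + n) % d             ∎
  where open ≡-Reasoning

AND-cong : ∀ n {f g : Fin n → Bool} → (∀ i → f i ≡ g i) → AND n f ≡ AND n g
AND-cong zero    eq = refl
AND-cong (suc n) eq = cong₂ _∧_ (eq zero) (AND-cong n (λ i → eq (suc i)))

AND-true : ∀ n → AND n (λ _ → true) ≡ true
AND-true zero    = refl
AND-true (suc n) = AND-true n

AND-∧ : ∀ n (f g : Fin n → Bool) → AND n f ∧ AND n g ≡ AND n (λ i → f i ∧ g i)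
AND-∧ zero    f g = refl
AND-∧ (suc n) f g = trans (∧-interchange (f zero) _ (g zero) _) (cong ((f zero ∧ g zero) ∧_) (AND-∧ n _ _))

AND-swap : ∀ m n (f : Fin m → Fin n → Bool) →
           AND m (λ i → AND n (f i)) ≡ AND n (λ j → AND m (λ i → f i j))
AND-swap zero    n f = sym (AND-true n)
AND-swap (suc m) n f = trans (cong (AND n (f zero) ∧_) (AND-swap m n (λ i → f (suc i)))) (AND-∧ n _ _)

AND-↑ : ∀ m n (f : Fin (m + n) → Bool) →
        AND (m + n) f ≡ AND m (λ i → f (i ↑ˡ n)) ∧ AND n (λ j → f (m ↑ʳ j))
AND-↑ zero    n f = refl
AND-↑ (suc m) n f = trans (cong (f zero ∧_) (AND-↑ m n (λ i → f (suc i)))) (sym (∧-assoc (f zero) _ _))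

AND-combine : ∀ m n (f : Fin (m * n) → Bool) → AND (m * n) f ≡ AND m (λ i → AND n (λ j → f (combine i j)))
AND-combine zero    n f = refl
AND-combine (suc m) n f = trans (AND-↑ n (m * n) f)
  (cong (AND n (λ j → f (j ↑ˡ (m * n))) ∧_) (AND-combine m n (λ i → f (n ↑ʳ i))))

AND-columns : ∀ m n (f : Fin (m * n) → Bool) → AND (m * n) f ≡ AND n (λ j → AND m (λ i → f (combine i j)))
AND-columns m n f = trans (AND-combine m n f) (AND-swap m n (λ i j → f (combine i j)))

AND-++-true : ∀ n e (x : Fin n → Bool) → AND (n + e) (x ++ (λ _ → true)) ≡ AND n x
AND-++-true n e x = begin
  AND (n + e) (x ++ (λ _ → true))   ≡⟨ AND-↑ n e _ ⟩
  AND n (λ i → (x ++ (λ _ → true)) (i ↑ˡ e)) ∧ AND e (λ j → (x ++ (λ _ → true)) (n ↑ʳ j))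
    ≡⟨ cong₂ _∧_ (AND-cong n (lookup-++ˡ x _)) (trans (AND-cong e (lookup-++ʳ x _)) (AND-true e)) ⟩
  AND n x ∧ true                    ≡⟨ ∧-identityʳ _ ⟩
  AND n x                           ∎
  where open ≡-Reasoning

weightedSum : (k : ℕ) → (Fin k → ℕ) → (Fin k → Bool) → ℕ
weightedSum k w x = sumFin k (λ j → w j * ind (x j))

modGate-toℕ : ∀ m .{{_ : NonZero m}} (P : ℕ → Bool) k w x →
              modGate m (λ s → P (toℕ s)) k w x ≡ P (weightedSum k w x % m)
modGate-toℕ m P k w x = cong P (toℕ-fromℕ< _)

modGate-cong : ∀ m .{{_ : NonZero m}} A k w {x y : Fin k → Bool} → (∀ i → x i ≡ y i) →
               modGate m A k w x ≡ modGate m A k w y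
modGate-cong m A k w eq = cong (λ s → A (s mod m)) (sumFin-cong k (λ i → cong (λ b → w i * ind b) (eq i)))

eval-cong : ∀ {k d} {ms : Vec ℕ d} (C : Circ k ms) {x y : Fin k → Bool} →
            (∀ i → x i ≡ y i) → eval C x ≡ eval C y
eval-cong output                eq = eq zero
eval-cong (layer m k′ gates C) eq = eval-cong C (λ g → modGate-cong m (proj₁ (gates g)) _ (proj₂ (gates g)) eq)

weightedSum-++-true : ∀ n e w (x : Fin n → Bool) →
  weightedSum (n + e) w (x ++ (λ _ → true))
    ≡ weightedSum n (λ i → w (i ↑ˡ e)) x + sumFin e (λ j → w (n ↑ʳ j) * 1)
weightedSum-++-true n e w x = trans (sumFin-↑ n e _)
  (cong₂ _+_ (sumFin-cong n (λ i → cong (λ b → w (i ↑ˡ e) * ind b) (lookup-++ˡ x _ i)))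
             (sumFin-cong e (λ j → cong (λ b → w (n ↑ʳ j) * ind b) (lookup-++ʳ x _ j))))

-- A gate fed constant-true wires absorbs their weight into a shift of its accepting set.
fixTrailingInputs : ∀ n e {d} {ms : Vec ℕ (suc d)} (C : Circ (n + e) ms) →
  Σ (Circ n ms) λ C′ → (∀ x → eval C′ x ≡ eval C (x ++ (λ _ → true))) × size C′ ≡ size C
fixTrailingInputs n e (layer m k′ gates C) = layer m k′ gates′ C , (λ x → eval-cong C (gate≡ x)) , refl
  where
  shift : Fin k′ → ℕ
  shift g = sumFin e (λ j → proj₂ (gates g) (n ↑ʳ j) * 1)
  gates′ : Fin k′ → (Fin m → Bool) × (Fin n → ℕ)
  gates′ g = (λ s → proj₁ (gates g) ((toℕ s + shift g) mod m)) , (λ i → proj₂ (gates g) (i ↑ˡ e))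
  gate≡ : ∀ x g → modGate m (proj₁ (gates′ g)) n (proj₂ (gates′ g)) x
                ≡ modGate m (proj₁ (gates g)) (n + e) (proj₂ (gates g)) (x ++ (λ _ → true))
  gate≡ x g = cong (proj₁ (gates g)) (fromℕ<-cong _ _ (begin
      (toℕ (S mod m) + shift g) % m ≡⟨ cong (λ s → (s + shift g) % m) (toℕ-fromℕ< _) ⟩
      (S % m + shift g) % m         ≡⟨ [m%d+n]%d≡[m+n]%d S (shift g) m ⟩
      (S + shift g) % m             ≡⟨ cong (_% m) (sym (weightedSum-++-true n e (proj₂ (gates g)) x)) ⟩
      weightedSum (n + e) (proj₂ (gates g)) (x ++ (λ _ → true)) % m ∎) _ _)
    where
    open ≡-Reasoning
    S = weightedSum n (proj₂ (gates′ g)) x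

ComputesAND : ∀ {n d} {ms : Vec ℕ d} → Circ n ms → Set
ComputesAND {n} C = ∀ x → eval C x ≡ AND n x

shrinkAND : ∀ {n L d} {ms : Vec ℕ (suc d)} → n ≤ L → (C : Circ L ms) → ComputesAND C →
            Σ (Circ n ms) λ C′ → ComputesAND C′ × size C′ ≡ size C
shrinkAND {n} n≤L C computes with m≤n⇒∃[o]m+o≡n n≤L
... | e , refl with fixTrailingInputs n e C
...   | C′ , eval≡ , size≡ = C′ , (λ x → trans (eval≡ x) (trans (computes _) (AND-++-true n e x))) , size≡

AND≡true⇒weightedSum-not≡0 : ∀ k w (y : Fin k → Bool) →
                             AND k y ≡ true → weightedSum k w (λ i → not (y i)) ≡ 0
AND≡true⇒weightedSum-not≡0 zero    w y _     = refl
AND≡true⇒weightedSum-not≡0 (suc k) w y all-y with y zero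
... | true = trans (cong (w zero * 0 +_) (AND≡true⇒weightedSum-not≡0 k (λ i → w (suc i)) (λ i → y (suc i)) all-y))
                   (trans (+-identityʳ _) (*-zeroʳ (w zero)))

module Solutions (p : ℕ) .{{_ : NonZero p}} (2≤p : 2 ≤ p) where

  digits : (r : ℕ) → Fin (p ^ r) → Fin r → ℕ
  digits (suc r) = uncurryFin {p} λ a₀ a → toℕ a₀ ∷ᶠ digits r a

  IsSolution : (r : ℕ) → (Fin r → Bool) → ℕ → Fin (p ^ r) → Bool
  IsSolution r y t a = (t + weightedSum r (digits r a) (λ k → not (y k))) % p ≡ᵇ 1

  #solutions : (r : ℕ) → (Fin r → Bool) → ℕ → ℕ
  #solutions r y t = sumFin (p ^ r) (λ a → ind (IsSolution r y t a))

  #solutions-suc : ∀ r y t → #solutions (suc r) y t ≡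
                   sumFin p (λ a₀ → #solutions r (λ k → y (suc k)) (t + toℕ a₀ * ind (not (y zero))))
  #solutions-suc r y t = trans (sumFin-combine p (p ^ r) _)
    (sumFin-cong p λ a₀ → sumFin-cong (p ^ r) λ a → trans
      (cong (λ c → ind ((t + weightedSum (suc r) c (λ k → not (y k))) % p ≡ᵇ 1))
            (uncurryFin-combine {p} (λ a₀ a → toℕ a₀ ∷ᶠ digits r a) a₀ a))
      (cong (λ s → ind (s % p ≡ᵇ 1)) (sym (+-assoc t _ _))))

  #solutions-AND≡true : ∀ r y t → AND r y ≡ true → #solutions r y t ≡ p ^ r * ind (t % p ≡ᵇ 1)
  #solutions-AND≡true r y t all-y = trans
    (sumFin-cong (p ^ r) λ a → cong (λ s → ind (s % p ≡ᵇ 1))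
      (trans (cong (t +_) (AND≡true⇒weightedSum-not≡0 r (digits r a) y all-y)) (+-identityʳ t)))
    (sumFin-const (p ^ r) _)

  #solutions-AND≡false : ∀ r y t → AND r y ≡ false → p * #solutions r y t ≡ p ^ r
  #solutions-AND≡false (suc r) y t some-¬y with AND r (λ k → y (suc k)) in tail-y
  ... | false = begin
    p * #solutions (suc r) y t                    ≡⟨ cong (p *_) (#solutions-suc r y t) ⟩
    p * sumFin p (λ a₀ → #solutions r y′ (t′ a₀)) ≡⟨ sym (sumFin-*ˡ p p _) ⟩
    sumFin p (λ a₀ → p * #solutions r y′ (t′ a₀))
      ≡⟨ sumFin-cong p (λ a₀ → #solutions-AND≡false r y′ (t′ a₀) tail-y) ⟩
    sumFin p (λ _ → p ^ r)                        ≡⟨ sumFin-const p (p ^ r) ⟩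
    p ^ suc r                                     ∎
    where
    open ≡-Reasoning
    y′ = λ k → y (suc k)
    t′ = λ (a₀ : Fin p) → t + toℕ a₀ * ind (not (y zero))
  ... | true = cong (p *_) (begin
    #solutions (suc r) y t
      ≡⟨ #solutions-suc r y t ⟩
    sumFin p (λ a₀ → #solutions r y′ (t + toℕ a₀ * ind (not (y zero))))
      ≡⟨ sumFin-cong p (λ a₀ → cong (λ b → #solutions r y′ (t + toℕ a₀ * ind (not b))) ¬y₀) ⟩
    sumFin p (λ a₀ → #solutions r y′ (t + toℕ a₀ * 1))
      ≡⟨ sumFin-cong p (λ a₀ → #solutions-AND≡true r y′ _ tail-y) ⟩
    sumFin p (λ a₀ → p ^ r * ind ((t + toℕ a₀ * 1) % p ≡ᵇ 1))
      ≡⟨ sumFin-*ˡ p (p ^ r) _ ⟩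
    p ^ r * sumFin p (λ a₀ → ind ((t + toℕ a₀ * 1) % p ≡ᵇ 1))
      ≡⟨ cong (p ^ r *_) (trans
           (sumFin-cong p (λ a₀ → cong (λ s → ind ((t + s) % p ≡ᵇ 1)) (*-identityʳ (toℕ a₀))))
           (sumFin-residue≡1 p 2≤p t)) ⟩
    p ^ r * 1
      ≡⟨ *-identityʳ (p ^ r) ⟩
    p ^ r ∎)
    where
    open ≡-Reasoning
    y′ = λ k → y (suc k)
    ¬y₀ : y zero ≡ false
    ¬y₀ = trans (sym (∧-identityʳ (y zero))) some-¬y

  #solutions≡p^r*[¬AND] : ∀ r y → #solutions (suc r) y 0 ≡ p ^ r * ind (not (AND (suc r) y))
  #solutions≡p^r*[¬AND] r y with AND (suc r) y in all-y
  ... | true = begin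
    #solutions (suc r) y 0       ≡⟨ #solutions-AND≡true (suc r) y 0 all-y ⟩
    p ^ suc r * ind (0 % p ≡ᵇ 1) ≡⟨ cong (λ s → p ^ suc r * ind (s ≡ᵇ 1)) (m<n⇒m%n≡m (>-nonZero⁻¹ p)) ⟩
    p ^ suc r * 0                ≡⟨ *-zeroʳ (p ^ suc r) ⟩
    0                            ≡⟨ sym (*-zeroʳ (p ^ r)) ⟩
    p ^ r * 0                    ∎
    where open ≡-Reasoning
  ... | false = trans (*-cancelˡ-≡ _ _ p (#solutions-AND≡false (suc r) y 0 all-y)) (sym (*-identityʳ (p ^ r)))

onBlock : ∀ {m n} → Fin n → (Fin m → ℕ) → Fin (m * n) → ℕ
onBlock v c = uncurryFin λ k v′ → ind (does (v′ ≟ v)) * c k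

sumFin-onBlock : ∀ m n (v : Fin n) (c : Fin m → ℕ) (f : Fin (m * n) → ℕ) →
                 sumFin (m * n) (λ u → onBlock v c u * f u) ≡ sumFin m (λ k → c k * f (combine k v))
sumFin-onBlock m n v c f = trans (sumFin-combine m n _) (sumFin-cong m λ k → trans
  (sumFin-cong n λ v′ → trans
    (cong (_* f (combine k v′)) (uncurryFin-combine {m} (λ k v′ → ind (does (v′ ≟ v)) * c k) k v′))
    (*-assoc (ind (does (v′ ≟ v))) (c k) _))
  (sumFin-indicator n v (λ v′ → c k * f (combine k v′))))

pred[p]*a*[b]+a≡a*[¬b]+p*[a*[b]] : ∀ p .{{_ : NonZero p}} a b →
                                   pred p * a * ind b + a ≡ a * ind (not b) + p * (a * ind b)
pred[p]*a*[b]+a≡a*[¬b]+p*[a*[b]] (suc p′) a true  = identity p′ a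
  where
  identity : ∀ p′ a → p′ * a * 1 + a ≡ a * 0 + suc p′ * (a * 1)
  identity = solve-∀
pred[p]*a*[b]+a≡a*[¬b]+p*[a*[b]] (suc p′) a false = identity p′ a
  where
  identity : ∀ p′ a → p′ * a * 0 + a ≡ a * 1 + suc p′ * (a * 0)
  identity = solve-∀

data PrimeChain (K : ℕ) : ∀ {d} → ℕ → Vec ℕ d → Set where
  []   : ∀ {p} → PrimeChain K p []
  step : ∀ {p q d} {qs : Vec ℕ d} → Prime q → p ≢ q → q ≤ K → PrimeChain K q qs → PrimeChain K p (q ∷ qs)

prime⇒2≤ : ∀ {p} → Prime p → 2 ≤ p
prime⇒2≤ prime-p = nonTrivial⇒n>1 _ {{prime⇒nonTrivial prime-p}}

module PrimeSolutions {p} .{{_ : NonZero p}} (prime-p : Prime p) = Solutions p (prime⇒2≤ prime-p)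

module Layers (r K : ℕ) where

  R : ℕ
  R = suc r

  Blocks : ℕ → Set
  Blocks d = Fin (R ^ d) → Fin R → Bool

  ANDBlocks : ∀ d → Blocks d → Bool
  ANDBlocks d y = AND (R ^ d) (λ v → AND R (y v))

  columnAND : ∀ d → Blocks (suc d) → Blocks d
  columnAND d y v k = AND R (y (combine k v))

  hits : ∀ {p} .{{_ : NonZero p}} → Prime p → ∀ d → Blocks d → Fin (R ^ d * p ^ R) → Bool
  hits prime-p d y = uncurryFin λ v → PrimeSolutions.IsSolution prime-p R (y v) 0

  weightedSum-hits : ∀ {p} .{{_ : NonZero p}} (prime-p : Prime p) d y (c : Fin (R ^ d) → ℕ) →
    weightedSum (R ^ d * p ^ R) (uncurryFin λ u _ → c u) (hits prime-p d y)
      ≡ p ^ r * weightedSum (R ^ d) c (λ u → not (AND R (y u)))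
  weightedSum-hits {p} prime-p d y c = begin
    sumFin (R ^ d * p ^ R) (uncurryFin λ u a → c u * ind (IsSolution R (y u) 0 a))
      ≡⟨ sumFin-uncurry (R ^ d) (p ^ R) _ ⟩
    sumFin (R ^ d) (λ u → sumFin (p ^ R) (λ a → c u * ind (IsSolution R (y u) 0 a)))
      ≡⟨ sumFin-cong (R ^ d) (λ u →
           trans (sumFin-*ˡ (p ^ R) (c u) _) (cong (c u *_) (#solutions≡p^r*[¬AND] r (y u)))) ⟩
    sumFin (R ^ d) (λ u → c u * (p ^ r * ind (not (AND R (y u)))))
      ≡⟨ sumFin-cong (R ^ d) (λ u → x∙yz≈y∙xz (c u) (p ^ r) _) ⟩
    sumFin (R ^ d) (λ u → p ^ r * (c u * ind (not (AND R (y u)))))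
      ≡⟨ sumFin-*ˡ (R ^ d) (p ^ r) _ ⟩
    p ^ r * weightedSum (R ^ d) c (λ u → not (AND R (y u))) ∎
    where
    open ≡-Reasoning
    open PrimeSolutions prime-p

  topGate : ∀ {p q} .{{_ : NonZero p}} .{{_ : NonZero q}} (prime-p : Prime p) (prime-q : Prime q) →
            p ≢ q → (y : Blocks 0) →
    modGate q (λ s → toℕ s ≡ᵇ 0) (1 * p ^ R) (λ _ → 1) (hits prime-p 0 y) ≡ ANDBlocks 0 y
  topGate {p} {q} prime-p prime-q p≢q y = begin
    modGate q (λ s → toℕ s ≡ᵇ 0) (1 * p ^ R) (λ _ → 1) (hits prime-p 0 y)
      ≡⟨ modGate-toℕ q (_≡ᵇ 0) (1 * p ^ R) (λ _ → 1) (hits prime-p 0 y) ⟩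
    weightedSum (1 * p ^ R) (λ _ → 1) (hits prime-p 0 y) % q ≡ᵇ 0
      ≡⟨ cong (λ s → s % q ≡ᵇ 0) (weightedSum-hits prime-p 0 y (λ _ → 1)) ⟩
    (p ^ r * (1 * ind (not (AND R (y zero))) + 0)) % q ≡ᵇ 0
      ≡⟨ cong (λ s → (p ^ r * s) % q ≡ᵇ 0) (trans (+-identityʳ _) (*-identityˡ _)) ⟩
    (p ^ r * ind (not (AND R (y zero)))) % q ≡ᵇ 0
      ≡⟨ e*[¬b]%q≡ᵇ0≡b (prime∤prime^ prime-p prime-q p≢q r) (AND R (y zero)) ⟩
    AND R (y zero)
      ≡⟨ sym (∧-identityʳ _) ⟩
    ANDBlocks 0 y ∎
    where
    open ≡-Reasoning

  middleGate : ∀ {p q} .{{_ : NonZero p}} .{{_ : NonZero q}} (prime-p : Prime p) (prime-q : Prime q) → p ≢ q →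
               ∀ d (y : Blocks (suc d)) v b →
    modGate q (λ s → toℕ s ≡ᵇ p ^ r % q) (R ^ suc d * p ^ R)
            (uncurryFin λ u _ → onBlock v (PrimeSolutions.digits prime-q R b) u) (hits prime-p (suc d) y)
      ≡ PrimeSolutions.IsSolution prime-q R (columnAND d y v) 0 b
  middleGate {p} {q} prime-p prime-q p≢q d y v b = begin
    modGate q (λ s → toℕ s ≡ᵇ p ^ r % q) (R ^ suc d * p ^ R) w (hits prime-p (suc d) y)
      ≡⟨ modGate-toℕ q (_≡ᵇ p ^ r % q) (R ^ suc d * p ^ R) w (hits prime-p (suc d) y) ⟩
    weightedSum (R ^ suc d * p ^ R) w (hits prime-p (suc d) y) % q ≡ᵇ p ^ r % q
      ≡⟨ cong (λ s → s % q ≡ᵇ p ^ r % q) (weightedSum-hits prime-p (suc d) y (onBlock v c)) ⟩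
    (p ^ r * weightedSum (R ^ suc d) (onBlock v c) (λ u → not (AND R (y u)))) % q ≡ᵇ p ^ r % q
      ≡⟨ cong (λ s → (p ^ r * s) % q ≡ᵇ p ^ r % q) (sumFin-onBlock R (R ^ d) v c _) ⟩
    (p ^ r * weightedSum R c (λ k → not (columnAND d y v k))) % q ≡ᵇ p ^ r % q
      ≡⟨ *-≡ᵇ-cancelˡ prime-q (prime∤prime^ prime-p prime-q p≢q r) _ ⟩
    weightedSum R c (λ k → not (columnAND d y v k)) % q ≡ᵇ 1 ∎
    where
    open ≡-Reasoning
    c = PrimeSolutions.digits prime-q R b
    w = uncurryFin λ u _ → onBlock v c u

  -- Weighting x_k by (p - 1)·a_k and shifting by Σ a_k replaces x_k by ¬ x_k modulo p.
  inputGate : ∀ {p} .{{_ : NonZero p}} (prime-p : Prime p) e (x : Fin (R ^ suc e) → Bool) v a →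
    let open PrimeSolutions prime-p in
    modGate p (λ s → (toℕ s + sumFin R (digits R a)) % p ≡ᵇ 1) (R ^ suc e)
              (onBlock v (λ k → pred p * digits R a k)) x
      ≡ IsSolution R (λ k → x (combine k v)) 0 a
  inputGate {p} prime-p e x v a = begin
    modGate p (λ s → (toℕ s + T) % p ≡ᵇ 1) (R ^ suc e) (onBlock v (λ k → pred p * c k)) x
      ≡⟨ modGate-toℕ p (λ s → (s + T) % p ≡ᵇ 1) (R ^ suc e) (onBlock v (λ k → pred p * c k)) x ⟩
    (weightedSum (R ^ suc e) (onBlock v (λ k → pred p * c k)) x % p + T) % p ≡ᵇ 1
      ≡⟨ cong (_≡ᵇ 1) ([m%d+n]%d≡[m+n]%d _ T p) ⟩
    (weightedSum (R ^ suc e) (onBlock v (λ k → pred p * c k)) x + T) % p ≡ᵇ 1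
      ≡⟨ cong (λ s → (s + T) % p ≡ᵇ 1)
              (sumFin-onBlock R (R ^ e) v (λ k → pred p * c k) (λ u → ind (x u))) ⟩
    (sumFin R (λ k → pred p * c k * X k) + T) % p ≡ᵇ 1
      ≡⟨ cong (λ s → s % p ≡ᵇ 1) (sym (sumFin-+ R (λ k → pred p * c k * X k) c)) ⟩
    sumFin R (λ k → pred p * c k * X k + c k) % p ≡ᵇ 1
      ≡⟨ cong (λ s → s % p ≡ᵇ 1)
              (sumFin-cong R (λ k → pred[p]*a*[b]+a≡a*[¬b]+p*[a*[b]] p (c k) (x (combine k v)))) ⟩
    sumFin R (λ k → c k * ind (not (x (combine k v))) + p * (c k * X k)) % p ≡ᵇ 1
      ≡⟨ cong (λ s → s % p ≡ᵇ 1) (trans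
           (sumFin-+ R (λ k → c k * ind (not (x (combine k v)))) (λ k → p * (c k * X k)))
           (cong (D +_) (sumFin-*ˡ R p (λ k → c k * X k)))) ⟩
    (D + p * sumFin R (λ k → c k * X k)) % p ≡ᵇ 1
      ≡⟨ cong (_≡ᵇ 1) (%-remove-+ʳ D (m∣m*n _)) ⟩
    D % p ≡ᵇ 1 ∎
    where
    open ≡-Reasoning
    open PrimeSolutions prime-p
    c = digits R a
    T = sumFin R c
    X = λ k → ind (x (combine k v))
    D = weightedSum R c (λ k → not (x (combine k v)))

  hitsToAND : ∀ d {p} .{{_ : NonZero p}} (prime-p : Prime p) {qs : Vec ℕ (suc d)} → PrimeChain K p qs →
    Σ (Circ (R ^ d * p ^ R) qs) λ C →
      (∀ y → eval C (hits prime-p d y) ≡ ANDBlocks d y) × size C ≤ suc d * (R ^ d * K ^ R)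
  hitsToAND zero {p} prime-p (step {q = q} prime-q p≢q q≤K []) =
    layer q 1 (λ _ → (λ s → toℕ s ≡ᵇ 0) , (λ _ → 1)) output ,
    topGate prime-p prime-q p≢q ,
    ≤-trans (≤-trans (m^n>0 q R) (^-monoˡ-≤ R q≤K)) (≤-reflexive (sym (trans (*-identityˡ _) (*-identityˡ _))))
    where
    instance
      _ = prime⇒nonZero prime-q
  hitsToAND (suc d) {p} prime-p (step {q = q} prime-q p≢q q≤K chain)
    with hitsToAND d {{prime⇒nonZero prime-q}} prime-q chain
  ... | C , computes , size≤ =
    layer q (R ^ d * q ^ R) gates C ,
    (λ y → trans (eval-cong C (gate≡ y))
                 (trans (computes (columnAND d y)) (sym (AND-columns R (R ^ d) (λ u → AND R (y u)))))) ,
    (begin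
      R ^ d * q ^ R + size C
        ≤⟨ +-mono-≤ (*-monoʳ-≤ (R ^ d) (^-monoˡ-≤ R q≤K)) size≤ ⟩
      suc (suc d) * (R ^ d * K ^ R)
        ≤⟨ *-monoʳ-≤ (suc (suc d)) (*-monoˡ-≤ (K ^ R) (m≤n*m (R ^ d) R)) ⟩
      suc (suc d) * (R ^ suc d * K ^ R) ∎)
    where
    open ≤-Reasoning
    instance
      _ = prime⇒nonZero prime-q
    gates : Fin (R ^ d * q ^ R) → (Fin q → Bool) × (Fin (R ^ suc d * p ^ R) → ℕ)
    gates = uncurryFin {R ^ d} λ v b →
      (λ s → toℕ s ≡ᵇ p ^ r % q) , (uncurryFin {R ^ suc d} λ u _ → onBlock v (PrimeSolutions.digits prime-q R b) u)
    gate≡ : ∀ y g → modGate q (proj₁ (gates g)) (R ^ suc d * p ^ R) (proj₂ (gates g)) (hits prime-p (suc d) y)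
                  ≡ hits prime-q d (columnAND d y) g
    gate≡ y g = middleGate prime-p prime-q p≢q d y (quotient (q ^ R) g) (remainder {R ^ d} (q ^ R) g)

  ANDCircuit : ∀ e {p} (prime-p : Prime p) → p ≤ K → {qs : Vec ℕ (suc e)} → PrimeChain K p qs →
    Σ (Circ (R ^ suc e) (p ∷ qs)) λ C → ComputesAND C × size C ≤ suc (suc e) * (R ^ e * K ^ R)
  ANDCircuit e {p} prime-p p≤K chain with hitsToAND e {{prime⇒nonZero prime-p}} prime-p chain
  ... | C , computes , size≤ =
    layer p (R ^ e * p ^ R) gates C ,
    (λ x → trans (eval-cong C (gate≡ x))
                 (trans (computes (λ v k → x (combine k v))) (sym (AND-columns R (R ^ e) x)))) ,
    +-mono-≤ (*-monoʳ-≤ (R ^ e) (^-monoˡ-≤ R p≤K)) size≤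
    where
    instance
      _ = prime⇒nonZero prime-p
    open PrimeSolutions prime-p
    gates : Fin (R ^ e * p ^ R) → (Fin p → Bool) × (Fin (R ^ suc e) → ℕ)
    gates = uncurryFin {R ^ e} λ v a →
      (λ s → (toℕ s + sumFin R (digits R a)) % p ≡ᵇ 1) , onBlock v (λ k → pred p * digits R a k)
    gate≡ : ∀ x g → modGate p (proj₁ (gates g)) (R ^ suc e) (proj₂ (gates g)) x
                  ≡ hits prime-p e (λ v k → x (combine k v)) g
    gate≡ x g = inputGate prime-p e x (quotient (p ^ R) g) (remainder {R ^ e} (p ^ R) g)

n≤2^n : ∀ n → n ≤ 2 ^ n
n≤2^n zero    = z≤n
n≤2^n (suc n) = +-mono-≤ (m^n>0 2 n) (≤-trans (n≤2^n n) (m≤m+n (2 ^ n) 0))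

a*[R^b*c^R]≤2^[[a+b+c]*R] : ∀ a b c r → a * (suc r ^ b * c ^ suc r) ≤ 2 ^ ((a + b + c) * suc r)
a*[R^b*c^R]≤2^[[a+b+c]*R] a b c r = begin
  a * (R ^ b * c ^ R)                          ≤⟨ *-mono-≤ a≤ (*-mono-≤ R^b≤ c^R≤) ⟩
  2 ^ (a * R) * (2 ^ (R * b) * 2 ^ (c * R))    ≡⟨ cong (2 ^ (a * R) *_) (sym (^-distribˡ-+-* 2 (R * b) (c * R))) ⟩
  2 ^ (a * R) * 2 ^ (R * b + c * R)            ≡⟨ sym (^-distribˡ-+-* 2 (a * R) _) ⟩
  2 ^ (a * R + (R * b + c * R))                ≡⟨ cong (2 ^_) (exponents a b c R) ⟩
  2 ^ ((a + b + c) * R)                        ∎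
  where
  open ≤-Reasoning
  R = suc r
  a≤ : a ≤ 2 ^ (a * R)
  a≤ = ≤-trans (n≤2^n a) (^-monoʳ-≤ 2 (m≤m*n a R))
  R^b≤ : R ^ b ≤ 2 ^ (R * b)
  R^b≤ = subst (R ^ b ≤_) (^-*-assoc 2 R b) (^-monoˡ-≤ b (n≤2^n R))
  c^R≤ : c ^ R ≤ 2 ^ (c * R)
  c^R≤ = subst (c ^ R ≤_) (^-*-assoc 2 c R) (^-monoˡ-≤ R (n≤2^n c))
  exponents : ∀ a b c R → a * R + (R * b + c * R) ≡ (a + b + c) * R
  exponents = solve-∀

lookup≤sum : ∀ {d} (v : Vec ℕ d) i → lookup v i ≤ sum v
lookup≤sum (x ∷ xs) zero    = m≤m+n x (sum xs)
lookup≤sum (x ∷ xs) (suc i) = ≤-trans (lookup≤sum xs i) (m≤n+m (sum xs) x)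

primeChain : ∀ {d} K p (qs : Vec ℕ d) →
  (∀ i → Prime (lookup (p ∷ qs) i)) →
  (∀ (i j : Fin (suc d)) → toℕ j ≡ suc (toℕ i) → lookup (p ∷ qs) i ≢ lookup (p ∷ qs) j) →
  (∀ i → lookup (p ∷ qs) i ≤ K) → PrimeChain K p qs
primeChain K p []       primes distinct bounded = []
primeChain K p (q ∷ qs) primes distinct bounded =
  step (primes (suc zero)) (distinct zero (suc zero) refl) (bounded (suc zero))
       (primeChain K q qs (λ i → primes (suc i)) (λ i j j≡1+i → distinct (suc i) (suc j) (cong suc j≡1+i))
                   (λ i → bounded (suc i)))

proposition4p2 : (h : ℕ) → 2 ≤ h → (p : Vec ℕ h) →
    (∀ i → Prime (lookup p i)) →
    (∀ (i j : Fin h) → toℕ j ≡ suc (toℕ i) → lookup p i ≢ lookup p j) →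
    ∃ λ (c : ℕ) → ∃ λ (n₀ : ℕ) → ∀ (n r : ℕ) → n₀ ≤ n → n ≤ r ^ (h ∸ 1) →
      Σ (CC n p) λ C → ((x : Fin n → Bool) → eval C x ≡ AND n x) × size C ≤ 2 ^ (c * r)
proposition4p2 (suc (suc e)) (s≤s (s≤s z≤n)) (p ∷ qs) primes distinct = suc (suc e) + e + K , 1 , circuit
  where
  K = sum (p ∷ qs)
  chain = primeChain K p qs primes distinct (lookup≤sum (p ∷ qs))
  circuit : ∀ n r → 1 ≤ n → n ≤ r ^ suc e →
    Σ (CC n (p ∷ qs)) λ C → ComputesAND C × size C ≤ 2 ^ ((suc (suc e) + e + K) * r)
  circuit (suc n) zero    _ ()
  circuit n       (suc r) _ n≤R^[e+1] with Layers.ANDCircuit r K e (primes zero) (lookup≤sum (p ∷ qs) zero) chain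
  ... | C , computes , size≤ with shrinkAND n≤R^[e+1] C computes
  ...   | C′ , computes′ , size≡ = C′ , computes′ ,
    subst (_≤ 2 ^ ((suc (suc e) + e + K) * suc r)) (sym size≡)
          (≤-trans size≤ (a*[R^b*c^R]≤2^[[a+b+c]*R] (suc (suc e)) e K r))
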